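{- Let $u,w\in\mathbf{L}$ with $u,w\notin X$. If $u\vee w$ covers both $u$ and $w$, then $u$ and $w$ both cover $u\wedge w$. Conversely, if $u$ and $w$ both cover $u\wedge w$ and $u\vee w\neq\hat1$, then $u\vee w$ covers both $u$ and $w$.
   Context: Let $d>1$ and let $(V,\omega)$ be one of: (i) $V=GF(q)^{2d}$ with a nondegenerate symplectic form; (ii) $V=GF(q)^{2d+1}$ with a nondegenerate quadratic form; (iii) $V=GF(q)^{2d}$ with a nondegenerate quadratic form of Witt index $d$; (iv) $V=GF(q)^{2d+2}$ with a nondegenerate quadratic form of Witt index $d$; (v) $V=GF(r^2)^{2d+1}$ with a nondegenerate Hermitian form; (vi) $V=GF(r^2)^{2d}$ with a nondegenerate Hermitian form. Isotropic subspaces are those on which the form vanishes; $\Omega_\ell$ is the set of isotropic subspaces of dimension $\ell$ ($0\le\ell\le d$), $X=\Omega_d$ (maximal isotropic subspaces), $\Omega_{d+1}=\{V\}$, $\hat1=V$. $\mathbf{L}=\bigcup_{\ell=0}^{d+1}\Omega_\ell$, ordered by inclusion, with $u\wedge w=u\cap w$ and $u\vee w$ equal to the span $u+w$ if that is isotropic, and $\hat1$ otherwise. The rank is $\mathrm{rk}(w)=\ell$ for $w\in\Omega_\ell$. An element $a$ covers $b$ if $b\subseteq a$ and $\mathrm{rk}(a)=\mathrm{rk}(b)+1$. -}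

module Defs where

open import Level using (0ℓ)
open import Data.Nat using (ℕ; zero; suc; _≤_) renaming (_+_ to _+ℕ_; _*_ to _*ℕ_)
open import Data.Fin using (Fin; zero; suc)
open import Data.Vec using (Vec; zipWith; map; replicate; lookup)
open import Data.Product using (Σ; ∃; ∃-syntax; _×_; _,_)
open import Data.Sum using (_⊎_)
open import Function using (_∘_)
open import Function.Bundles using (_↔_)
open import Relation.Nullary using (¬_)
open import Relation.Binary.PropositionalEquality using (_≡_; _≢_)
open import Algebra.Core using (Op₁; Op₂)
open import Algebra.Structures using (IsCommutativeRing)

-- A finite field (equality is propositional equality).
-- Its size is automatically a prime power q, so this is GF(q).

record FiniteField : Set₁ where
  infixl 7 _*_
  infixl 6 _+_
  field
    Carrier    : Set
    _+_ _*_    : Op₂ Carrier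
    -_         : Op₁ Carrier
    0# 1#      : Carrier
    isCommutativeRing : IsCommutativeRing _≡_ _+_ _*_ -_ 0# 1#
    0≢1        : 0# ≢ 1#
    inverse    : ∀ x → x ≢ 0# → ∃[ y ] (x * y ≡ 1#)
    size       : ℕ
    enumeration : Carrier ↔ Fin size

module _ (F : FiniteField) where
  open FiniteField F

  pow : Carrier → ℕ → Carrier
  pow x zero    = 1#
  pow x (suc n) = x * pow x n

  Vect : ℕ → Set
  Vect m = Vec Carrier m

  zeroV : ∀ {m} → Vect m
  zeroV = replicate _ 0#

  _⊕_ : ∀ {m} → Vect m → Vect m → Vect m
  _⊕_ = zipWith _+_

  _·_ : ∀ {m} → Carrier → Vect m → Vect m
  c · x = map (c *_) x

  sumF : ∀ {n} → (Fin n → Carrier) → Carrier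
  sumF {zero}  f = 0#
  sumF {suc n} f = f zero + sumF (f ∘ suc)

  lincomb : ∀ {ℓ m} → (Fin ℓ → Carrier) → (Fin ℓ → Vect m) → Vect m
  lincomb {zero}  c b = zeroV
  lincomb {suc ℓ} c b = (c zero · b zero) ⊕ lincomb (c ∘ suc) (b ∘ suc)

  Subset : ℕ → Set₁
  Subset m = Vect m → Set

  _⊆_ : ∀ {m} → Subset m → Subset m → Set
  S ⊆ T = ∀ x → S x → T x

  _≐_ : ∀ {m} → Subset m → Subset m → Set
  S ≐ T = S ⊆ T × T ⊆ S

  Full : ∀ {m} → Subset m → Set
  Full S = ∀ x → S x

  record IsSubspace {m} (S : Subset m) : Set where
    field
      zero∈ : S zeroV
      ⊕∈    : ∀ x y → S x → S y → S (x ⊕ y)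
      ·∈    : ∀ c x → S x → S (c · x)

  HasDim : ∀ {m} → Subset m → ℕ → Set
  HasDim {m} S ℓ =
    Σ (Fin ℓ → Vect m) λ b →
      (∀ i → S (b i))
      × (∀ c → lincomb c b ≡ zeroV → ∀ i → c i ≡ 0#)
      × (∀ x → S x → ∃[ c ] (x ≡ lincomb c b))

  _∩_ : ∀ {m} → Subset m → Subset m → Subset m
  (S ∩ T) x = S x × T x

  span : ∀ {m} → Subset m → Subset m → Subset m
  span S T x = ∃[ y ] ∃[ z ] (S y × T z × x ≡ y ⊕ z)

  Matrix : ℕ → Set
  Matrix m = Fin m → Fin m → Carrier

  bilin : ∀ {m} → Matrix m → Vect m → Vect m → Carrier
  bilin M x y = sumF λ i → sumF λ j → lookup x i * (M i j * lookup y j)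

  quad : ∀ {m} → Matrix m → Vect m → Carrier
  quad A x = bilin A x x

  polar : ∀ {m} → Matrix m → Vect m → Vect m → Carrier
  polar A x y = quad A (x ⊕ y) + (- quad A x) + (- quad A y)

  herm : ∀ {m} → ℕ → Matrix m → Vect m → Vect m → Carrier
  herm r M x y = sumF λ i → sumF λ j → lookup x i * (M i j * pow (lookup y j) r)

  IsSymplectic : ∀ {m} → Matrix m → Set
  IsSymplectic M = (∀ x → bilin M x x ≡ 0#)
                 × (∀ x → (∀ y → bilin M x y ≡ 0#) → x ≡ zeroV)

  IsNondegQuadratic : ∀ {m} → Matrix m → Set
  IsNondegQuadratic A = ∀ x → quad A x ≡ 0# → (∀ y → polar A x y ≡ 0#) → x ≡ zeroV

  TotallySingular : ∀ {m} → Matrix m → Subset m → Set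
  TotallySingular A S = ∀ x → S x → quad A x ≡ 0#

  HasWittIndex : ∀ {m} → Matrix m → ℕ → Set₁
  HasWittIndex {m} A k =
    (Σ (Subset m) λ S → IsSubspace S × TotallySingular A S × HasDim S k)
    × (∀ (S : Subset m) ℓ → IsSubspace S → TotallySingular A S → HasDim S ℓ → ℓ ≤ k)

  -- nondegenerate Hermitian form over GF(r²) w.r.t. σ(a) = a^r
  IsNondegHermitian : ∀ {m} → ℕ → Matrix m → Set
  IsNondegHermitian r M = (∀ i j → M j i ≡ pow (M i j) r)
                        × (∀ x → (∀ y → herm r M x y ≡ 0#) → x ≡ zeroV)

  data PolarSpace (d : ℕ) : Set₁ where
    symplectic : (M : Matrix (2 *ℕ d)) → IsSymplectic M → PolarSpace d
    parabolic  : (A : Matrix (suc (2 *ℕ d))) → IsNondegQuadratic A → PolarSpace d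
    hyperbolic : (A : Matrix (2 *ℕ d)) → IsNondegQuadratic A → HasWittIndex A d
               → PolarSpace d
    elliptic   : (A : Matrix (2 *ℕ d +ℕ 2)) → IsNondegQuadratic A → HasWittIndex A d
               → PolarSpace d
    hermitianOdd  : (r : ℕ) → size ≡ r *ℕ r → (M : Matrix (suc (2 *ℕ d)))
                  → IsNondegHermitian r M → PolarSpace d
    hermitianEven : (r : ℕ) → size ≡ r *ℕ r → (M : Matrix (2 *ℕ d))
                  → IsNondegHermitian r M → PolarSpace d

  dim : ∀ {d} → PolarSpace d → ℕ
  dim {d} (symplectic _ _)          = 2 *ℕ d
  dim {d} (parabolic _ _)           = suc (2 *ℕ d)
  dim {d} (hyperbolic _ _ _)        = 2 *ℕ d
  dim {d} (elliptic _ _ _)          = 2 *ℕ d +ℕ 2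
  dim {d} (hermitianOdd _ _ _ _)    = suc (2 *ℕ d)
  dim {d} (hermitianEven _ _ _ _)   = 2 *ℕ d

  Isotropic : ∀ {d} (P : PolarSpace d) → Subset (dim P) → Set
  Isotropic (symplectic M _)          S = ∀ x y → S x → S y → bilin M x y ≡ 0#
  Isotropic (parabolic A _)           S = TotallySingular A S
  Isotropic (hyperbolic A _ _)        S = TotallySingular A S
  Isotropic (elliptic A _ _)          S = TotallySingular A S
  Isotropic (hermitianOdd r _ M _)    S = ∀ x y → S x → S y → herm r M x y ≡ 0#
  Isotropic (hermitianEven r _ M _)   S = ∀ x y → S x → S y → herm r M x y ≡ 0#

  InΩ : ∀ {d} (P : PolarSpace d) → ℕ → Subset (dim P) → Set
  InΩ {d} P ℓ S = IsSubspace S × Isotropic P S × HasDim S ℓ × ℓ ≤ d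

  InL : ∀ {d} (P : PolarSpace d) → Subset (dim P) → Set
  InL P S = IsSubspace S × (Isotropic P S ⊎ Full S)

  InX : ∀ {d} (P : PolarSpace d) → Subset (dim P) → Set
  InX {d} P S = InΩ P d S

  Rank : ∀ {d} (P : PolarSpace d) → Subset (dim P) → ℕ → Set
  Rank {d} P S ℓ = InΩ P ℓ S ⊎ (Full S × ℓ ≡ suc d)

  Covers : ∀ {d} (P : PolarSpace d) → Subset (dim P) → Subset (dim P) → Set
  Covers P a b = b ⊆ a × ∃[ ℓ ] (Rank P b ℓ × Rank P a (suc ℓ))

  -- j = u ∨ w : the span u+w if isotropic, else V (= 1̂)
  IsJoin : ∀ {d} (P : PolarSpace d) → (u w j : Subset (dim P)) → Set
  IsJoin P u w j = (Isotropic P (span u w) × j ≐ span u w)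
                 ⊎ (¬ Isotropic P (span u w) × Full j)

-- Whenever a cover relation from the statement holds, u, w, u ∧ w and u ∨ w are all proper isotropic
-- subspaces, ranked by dimension: V covers only maximal elements, and u = V covering u ∩ w would make
-- w = u ∩ w maximal; moreover u ∨ w = u + w. Both implications then reduce to the codimension-one case
-- of Grassmann's formula dim (u + w) + dim (u ∩ w) = dim u + dim w, proved with a vector z ∈ w ∖ u:
-- adjoining z to a basis of u gives a basis of u + w, and adjoining it to a basis of u ∩ w gives a
-- basis of w. Dimension is well defined because p independent vectors in the span of q vectors give an
-- injection F^p → F^q, so p ≤ q.

module Submission where

open import Algebra.Bundles using (CommutativeRing; CommutativeSemigroup)
import Algebra.Properties.CommutativeSemigroup as CommutativeSemigroupProperties
import Algebra.Properties.Group as GroupProperties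
import Algebra.Properties.Ring as RingProperties
open import Algebra.Structures using (IsCommutativeRing)
open import Data.Empty using (⊥-elim)
open import Data.Fin as Fin using (Fin; zero; suc; funToFin; finToFun)
import Data.Fin.Properties as Fin
open import Data.Nat as ℕ using (ℕ; zero; suc; _<_; _≤_; _^_)
import Data.Nat.Properties as ℕ
open import Data.Product using (∃-syntax; _×_; _,_; proj₁; proj₂)
open import Data.Sum using (_⊎_; inj₁; inj₂)
open import Data.Vec as Vec using ([]; _∷_; lookup; tabulate; replicate)
import Data.Vec.Properties as Vec
open import Data.Vec.Functional using () renaming (_∷_ to _∷ᶠ_)
open import Function using (_∘_)
open import Function.Bundles using (Inverse; Injection)
open import Function.Properties.Inverse using (↔⇒↣)
open import Level using (0ℓ)
open import Relation.Binary.Definitions using (DecidableEquality)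
open import Relation.Binary.PropositionalEquality
open import Relation.Nullary using (¬_; Dec; yes; no)
open import Relation.Nullary.Decidable using (map′; _×-dec_; ¬?; decidable-stable)

open import Defs hiding (_⊆_; _≐_; _⊕_; _·_; zeroV; lincomb; span; HasDim; IsSubspace)
import Defs

open ≡-Reasoning

module LinearAlgebra (F : FiniteField) where

  open FiniteField F
  open IsCommutativeRing isCommutativeRing
    using ( +-assoc; +-comm; +-identityˡ; +-identityʳ; -‿inverseʳ
          ; *-assoc; *-comm; *-identityˡ; distribˡ; distribʳ; zeroˡ; zeroʳ )
  open Inverse enumeration using (to; from; strictlyInverseˡ; strictlyInverseʳ)

  infixl 6 _⊕_
  infixr 7 _·_
  infix 4 _⊆_

  _⊕_ : ∀ {m} → Vect F m → Vect F m → Vect F m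
  _⊕_ = Defs._⊕_ F

  _·_ : ∀ {m} → Carrier → Vect F m → Vect F m
  _·_ = Defs._·_ F

  0ᵥ : ∀ {m} → Vect F m
  0ᵥ = Defs.zeroV F

  ⊖_ : ∀ {m} → Vect F m → Vect F m
  ⊖ x = (- 1#) · x

  lincomb : ∀ {p m} → (Fin p → Carrier) → (Fin p → Vect F m) → Vect F m
  lincomb = Defs.lincomb F

  _⊆_ : ∀ {m} → Subset F m → Subset F m → Set
  _⊆_ = Defs._⊆_ F

  _≐_ : ∀ {m} → Subset F m → Subset F m → Set
  _≐_ = Defs._≐_ F

  span : ∀ {m} → Subset F m → Subset F m → Subset F m
  span = Defs.span F

  IsSubspace : ∀ {m} → Subset F m → Set
  IsSubspace = Defs.IsSubspace F

  HasDim : ∀ {m} → Subset F m → ℕ → Set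
  HasDim = Defs.HasDim F

  open Defs.IsSubspace

  private
    variable
      m n p q k ℓ : ℕ
      x y z : Vect F m
      S T U W : Subset F m

  to-injective : ∀ {a b} → to a ≡ to b → a ≡ b
  to-injective = Injection.injective (↔⇒↣ enumeration)

  _≟_ : DecidableEquality Carrier
  _≟_ = Fin.inj⇒≟ (↔⇒↣ enumeration)

  commutativeRing : CommutativeRing 0ℓ 0ℓ
  commutativeRing = record
    { Carrier = Carrier ; _≈_ = _≡_ ; _+_ = _+_ ; _*_ = _*_ ; -_ = -_ ; 0# = 0# ; 1# = 1#
    ; isCommutativeRing = isCommutativeRing }

  open RingProperties (CommutativeRing.ring commutativeRing) using (-1*x≈-x)
  open GroupProperties (CommutativeRing.+-group commutativeRing) using (x∙y⁻¹≈ε⇒x≈y)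

  ⊕-assoc : (x y z : Vect F m) → (x ⊕ y) ⊕ z ≡ x ⊕ (y ⊕ z)
  ⊕-assoc = Vec.zipWith-assoc +-assoc

  ⊕-comm : (x y : Vect F m) → x ⊕ y ≡ y ⊕ x
  ⊕-comm []      []      = refl
  ⊕-comm (a ∷ x) (b ∷ y) = cong₂ _∷_ (+-comm a b) (⊕-comm x y)

  ⊕-identityˡ : (x : Vect F m) → 0ᵥ ⊕ x ≡ x
  ⊕-identityˡ = Vec.zipWith-identityˡ +-identityˡ

  ⊕-identityʳ : (x : Vect F m) → x ⊕ 0ᵥ ≡ x
  ⊕-identityʳ = Vec.zipWith-identityʳ +-identityʳ

  ·-distribˡ : ∀ a (x y : Vect F m) → a · (x ⊕ y) ≡ a · x ⊕ a · y
  ·-distribˡ a []      []      = refl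
  ·-distribˡ a (b ∷ x) (c ∷ y) = cong₂ _∷_ (distribˡ a b c) (·-distribˡ a x y)

  ·-distribʳ : ∀ a b (x : Vect F m) → (a + b) · x ≡ a · x ⊕ b · x
  ·-distribʳ a b []      = refl
  ·-distribʳ a b (c ∷ x) = cong₂ _∷_ (distribʳ c a b) (·-distribʳ a b x)

  ·-assoc : ∀ a b (x : Vect F m) → a · b · x ≡ (a * b) · x
  ·-assoc a b x = trans (sym (Vec.map-∘ (a *_) (b *_) x)) (Vec.map-cong (sym ∘ *-assoc a b) x)

  ·-identityˡ : (x : Vect F m) → 1# · x ≡ x
  ·-identityˡ x = trans (Vec.map-cong *-identityˡ x) (Vec.map-id x)

  ·-zeroˡ : (x : Vect F m) → 0# · x ≡ 0ᵥ
  ·-zeroˡ []      = refl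
  ·-zeroˡ (c ∷ x) = cong₂ _∷_ (zeroˡ c) (·-zeroˡ x)

  ·-zeroʳ : ∀ a → a · 0ᵥ {m} ≡ 0ᵥ
  ·-zeroʳ {m} a = trans (Vec.map-replicate (a *_) 0# m) (cong (replicate m) (zeroʳ a))

  ⊕-inverseʳ : (x : Vect F m) → x ⊕ ⊖ x ≡ 0ᵥ
  ⊕-inverseʳ x = begin
    x ⊕ ⊖ x                ≡⟨ cong (_⊕ ⊖ x) (sym (·-identityˡ x)) ⟩
    1# · x ⊕ (- 1#) · x    ≡⟨ sym (·-distribʳ 1# (- 1#) x) ⟩
    (1# + - 1#) · x        ≡⟨ cong (_· x) (-‿inverseʳ 1#) ⟩
    0# · x                 ≡⟨ ·-zeroˡ x ⟩
    0ᵥ                     ∎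

  ⊕-commutativeSemigroup : ℕ → CommutativeSemigroup 0ℓ 0ℓ
  ⊕-commutativeSemigroup m = record
    { Carrier = Vect F m ; _≈_ = _≡_ ; _∙_ = _⊕_
    ; isCommutativeSemigroup = record
      { isSemigroup = record
        { isMagma = record { isEquivalence = isEquivalence ; ∙-cong = cong₂ _⊕_ }
        ; assoc = ⊕-assoc }
      ; comm = ⊕-comm } }

  module ⊕ {m} = CommutativeSemigroupProperties (⊕-commutativeSemigroup m)

  ⊕-cancelʳ : (x y : Vect F m) → (x ⊕ y) ⊕ ⊖ x ≡ y
  ⊕-cancelʳ x y = begin
    (x ⊕ y) ⊕ ⊖ x   ≡⟨ cong (_⊕ ⊖ x) (⊕-comm x y) ⟩
    (y ⊕ x) ⊕ ⊖ x   ≡⟨ ⊕-assoc y x (⊖ x) ⟩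
    y ⊕ (x ⊕ ⊖ x)   ≡⟨ cong (y ⊕_) (⊕-inverseʳ x) ⟩
    y ⊕ 0ᵥ          ≡⟨ ⊕-identityʳ y ⟩
    y               ∎

  ⊕≡0⇒≡⊖ : x ⊕ y ≡ 0ᵥ → x ≡ ⊖ y
  ⊕≡0⇒≡⊖ {x = x} {y} x⊕y≡0 = begin
    x                 ≡⟨ sym (⊕-cancelʳ y x) ⟩
    (y ⊕ x) ⊕ ⊖ y     ≡⟨ cong (λ v → v ⊕ ⊖ y) (trans (⊕-comm y x) x⊕y≡0) ⟩
    0ᵥ ⊕ ⊖ y          ≡⟨ ⊕-identityˡ (⊖ y) ⟩
    ⊖ y               ∎

  lincomb-cong : {c c' : Fin p → Carrier} (b : Fin p → Vect F m) →
                 (∀ i → c i ≡ c' i) → lincomb c b ≡ lincomb c' b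
  lincomb-cong {zero}  b c≗c' = refl
  lincomb-cong {suc p} b c≗c' =
    cong₂ _⊕_ (cong (_· b zero) (c≗c' zero)) (lincomb-cong (b ∘ suc) (c≗c' ∘ suc))

  lincomb-+ : (c c' : Fin p → Carrier) (b : Fin p → Vect F m) →
              lincomb (λ i → c i + c' i) b ≡ lincomb c b ⊕ lincomb c' b
  lincomb-+ {zero}  c c' b = sym (⊕-identityˡ 0ᵥ)
  lincomb-+ {suc p} c c' b =
    trans (cong₂ _⊕_ (·-distribʳ (c zero) (c' zero) (b zero)) (lincomb-+ (c ∘ suc) (c' ∘ suc) (b ∘ suc)))
          (⊕.interchange _ _ _ _)

  lincomb-· : ∀ a (c : Fin p → Carrier) (b : Fin p → Vect F m) →
              a · lincomb c b ≡ lincomb (λ i → a * c i) b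
  lincomb-· {zero}  a c b = ·-zeroʳ a
  lincomb-· {suc p} a c b =
    trans (·-distribˡ a _ _) (cong₂ _⊕_ (·-assoc a (c zero) (b zero)) (lincomb-· a (c ∘ suc) (b ∘ suc)))

  lincomb-∈ : IsSubspace S → (b : Fin p → Vect F m) → (∀ i → S (b i)) → ∀ c → S (lincomb c b)
  lincomb-∈ {p = zero}  S-sub b bS c = zero∈ S-sub
  lincomb-∈ {p = suc p} S-sub b bS c =
    ⊕∈ S-sub _ _ (·∈ S-sub (c zero) (b zero) (bS zero)) (lincomb-∈ S-sub (b ∘ suc) (bS ∘ suc) (c ∘ suc))

  ∈-cancelˡ : IsSubspace S → S x → S (x ⊕ y) → S y
  ∈-cancelˡ {S = S} {x = x} {y} S-sub Sx Sx⊕y =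
    subst S (⊕-cancelʳ x y) (⊕∈ S-sub _ _ Sx⊕y (·∈ S-sub (- 1#) x Sx))

  Independent : (Fin p → Vect F m) → Set
  Independent b = ∀ c → lincomb c b ≡ 0ᵥ → ∀ i → c i ≡ 0#

  _∈Span_ : Vect F m → (Fin p → Vect F m) → Set
  x ∈Span b = ∃[ c ] (x ≡ lincomb c b)

  Spans : Subset F m → (Fin p → Vect F m) → Set
  Spans S b = ∀ x → S x → x ∈Span b

  lincomb-injective : {b : Fin p → Vect F m} → Independent b →
                      ∀ c c' → lincomb c b ≡ lincomb c' b → ∀ i → c i ≡ c' i
  lincomb-injective {b = b} b-ind c c' c≡c' i =
    x∙y⁻¹≈ε⇒x≈y (c i) (c' i) (trans (cong (c i +_) (sym (-1*x≈-x (c' i)))) (b-ind d d≡0 i))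
    where
      d : Fin _ → Carrier
      d i = c i + (- 1#) * c' i
      d≡0 : lincomb d b ≡ 0ᵥ
      d≡0 = begin
        lincomb d b                                 ≡⟨ lincomb-+ c _ b ⟩
        lincomb c b ⊕ lincomb (λ i → (- 1#) * c' i) b ≡⟨ cong (lincomb c b ⊕_) (sym (lincomb-· (- 1#) c' b)) ⟩
        lincomb c b ⊕ ⊖ lincomb c' b                ≡⟨ cong (λ v → lincomb c b ⊕ ⊖ v) (sym c≡c') ⟩
        lincomb c b ⊕ ⊖ lincomb c b                 ≡⟨ ⊕-inverseʳ _ ⟩
        0ᵥ                                          ∎

  ∷-independent : {v : Fin p → Vect F m} → Independent v → ¬ x ∈Span v → Independent (x ∷ᶠ v)
  ∷-independent {x = x} {v} v-ind x∉v c lincomb≡0 with c zero ≟ 0#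
  ... | yes c₀≡0 = λ { zero → c₀≡0 ; (suc i) → v-ind (c ∘ suc) tail≡0 i }
    where
      tail≡0 : lincomb (c ∘ suc) v ≡ 0ᵥ
      tail≡0 = begin
        lincomb (c ∘ suc) v                ≡⟨ sym (⊕-identityˡ _) ⟩
        0ᵥ ⊕ lincomb (c ∘ suc) v           ≡⟨ cong (_⊕ lincomb (c ∘ suc) v) (sym (·-zeroˡ x)) ⟩
        0# · x ⊕ lincomb (c ∘ suc) v       ≡⟨ cong (λ a → a · x ⊕ lincomb (c ∘ suc) v) (sym c₀≡0) ⟩
        c zero · x ⊕ lincomb (c ∘ suc) v   ≡⟨ lincomb≡0 ⟩
        0ᵥ                                 ∎
  ... | no c₀≢0 = ⊥-elim (x∉v (_ , x≡))
    where
      c₀⁻¹ : Carrier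
      c₀⁻¹ = proj₁ (inverse (c zero) c₀≢0)
      c₀c₀⁻¹≡1 : c zero * c₀⁻¹ ≡ 1#
      c₀c₀⁻¹≡1 = proj₂ (inverse (c zero) c₀≢0)
      x≡ : x ≡ lincomb (λ i → c₀⁻¹ * ((- 1#) * c (suc i))) v
      x≡ = begin
        x                                     ≡⟨ sym (·-identityˡ x) ⟩
        1# · x                                ≡⟨ cong (_· x) (trans (sym c₀c₀⁻¹≡1) (*-comm _ _)) ⟩
        (c₀⁻¹ * c zero) · x                   ≡⟨ sym (·-assoc c₀⁻¹ _ x) ⟩
        c₀⁻¹ · c zero · x                     ≡⟨ cong (c₀⁻¹ ·_) (⊕≡0⇒≡⊖ lincomb≡0) ⟩
        c₀⁻¹ · ⊖ lincomb (c ∘ suc) v          ≡⟨ cong (c₀⁻¹ ·_) (lincomb-· _ _ v) ⟩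
        c₀⁻¹ · lincomb (λ i → (- 1#) * c (suc i)) v ≡⟨ lincomb-· _ _ v ⟩
        lincomb (λ i → c₀⁻¹ * ((- 1#) * c (suc i))) v ∎

  any? : (P : Carrier → Set) → (∀ a → Dec (P a)) → Dec (∃[ a ] P a)
  any? P P? = map′ (λ (k , Pk) → from k , Pk)
                   (λ (a , Pa) → to a , subst P (sym (strictlyInverseʳ a)) Pa)
                   (Fin.any? (P? ∘ from))

  anyᵥ? : (P : Vect F m → Set) → (∀ x → Dec (P x)) → Dec (∃[ x ] P x)
  anyᵥ? {zero}  P P? = map′ ([] ,_) (λ { ([] , P[]) → P[] }) (P? [])
  anyᵥ? {suc m} P P? =
    map′ (λ (a , x , Pax) → a ∷ x , Pax) (λ { (a ∷ x , Pax) → a , x , Pax })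
         (any? _ λ a → anyᵥ? (P ∘ (a ∷_)) (P? ∘ (a ∷_)))

  _∈Span?_ : (x : Vect F m) (b : Fin p → Vect F m) → Dec (x ∈Span b)
  x ∈Span? b =
    map′ (λ (c , x≡) → lookup c , x≡)
         (λ (c , x≡) → tabulate c , trans x≡ (lincomb-cong b (sym ∘ Vec.lookup∘tabulate c)))
         (anyᵥ? _ λ c → Vec.≡-dec _≟_ x (lincomb (lookup c) b))

  1<size : 1 < size
  1<size = distinct⇒1< (to 0#) (to 1#) (0≢1 ∘ to-injective)
    where
      distinct⇒1< : ∀ {n} (i j : Fin n) → i ≢ j → 1 < n
      distinct⇒1< {suc zero}    zero zero i≢j = ⊥-elim (i≢j refl)
      distinct⇒1< {suc (suc n)} _    _    _   = ℕ.s≤s (ℕ.s≤s ℕ.z≤n)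

  funToFin-cong : {f g : Fin p → Fin n} → (∀ i → f i ≡ g i) → funToFin f ≡ funToFin g
  funToFin-cong {zero}  f≗g = refl
  funToFin-cong {suc p} f≗g = cong₂ Fin.combine (f≗g zero) (funToFin-cong (f≗g ∘ suc))

  -- Via funToFin the injection gives |F|^p ≤ |F|^q, hence p ≤ q as |F| > 1.
  pointwiseInjective⇒≤ : (g : (Fin p → Carrier) → (Fin q → Carrier)) →
                         (∀ c c' → (∀ i → g c i ≡ g c' i) → ∀ i → c i ≡ c' i) → p ≤ q
  pointwiseInjective⇒≤ {p} {q} g g-injective =
    ℕ.≮⇒≥ (λ q<p → ℕ.<⇒≱ (ℕ.^-monoʳ-< size 1<size q<p) (Fin.injective⇒≤ encode-injective))
    where
      decode : Fin (size ^ p) → Fin p → Carrier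
      decode k = from ∘ finToFun k
      encode : Fin (size ^ p) → Fin (size ^ q)
      encode k = funToFin (to ∘ g (decode k))
      encode-injective : ∀ {k k'} → encode k ≡ encode k' → k ≡ k'
      encode-injective {k} {k'} ek≡ek' = begin
        k                                     ≡⟨ sym (Fin.funToFin-finToFin {p} {size} k) ⟩
        funToFin (finToFun {size} {p} k)      ≡⟨ funToFin-cong digits≗ ⟩
        funToFin (finToFun {size} {p} k')     ≡⟨ Fin.funToFin-finToFin {p} {size} k' ⟩
        k'                                    ∎
        where
          images≗ : ∀ i → g (decode k) i ≡ g (decode k') i
          images≗ i = to-injective (begin
            to (g (decode k) i)      ≡⟨ sym (Fin.finToFun-funToFin (to ∘ g (decode k)) i) ⟩
            finToFun (encode k) i    ≡⟨ cong (λ e → finToFun e i) ek≡ek' ⟩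
            finToFun (encode k') i   ≡⟨ Fin.finToFun-funToFin (to ∘ g (decode k')) i ⟩
            to (g (decode k') i)     ∎)
          digits≗ : ∀ i → finToFun k i ≡ finToFun k' i
          digits≗ i = begin
            finToFun k i                ≡⟨ sym (strictlyInverseˡ _) ⟩
            to (decode k i)             ≡⟨ cong to (g-injective _ _ images≗ i) ⟩
            to (decode k' i)            ≡⟨ strictlyInverseˡ _ ⟩
            finToFun k' i               ∎

  independent≤spanning : (v : Fin p → Vect F m) (w : Fin q → Vect F m) →
                         Independent v → (∀ i → T (v i)) → IsSubspace T → Spans T w → p ≤ q
  independent≤spanning {p = p} {q = q} v w v-ind vT T-sub w-spans =
    pointwiseInjective⇒≤ coordinates coordinates-injective
    where
      expansion : ∀ c → lincomb c v ∈Span w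
      expansion c = w-spans (lincomb c v) (lincomb-∈ T-sub v vT c)
      coordinates : (Fin p → Carrier) → Fin q → Carrier
      coordinates c = proj₁ (expansion c)
      coordinates-injective : ∀ c c' → (∀ i → coordinates c i ≡ coordinates c' i) → ∀ i → c i ≡ c' i
      coordinates-injective c c' same =
        lincomb-injective v-ind c c'
          (trans (proj₂ (expansion c)) (trans (lincomb-cong w same) (sym (proj₂ (expansion c')))))

  independent≤ambient : (v : Fin p → Vect F m) → Independent v → p ≤ m
  independent≤ambient v v-ind =
    pointwiseInjective⇒≤ (λ c → lookup (lincomb c v)) λ c c' same →
      lincomb-injective v-ind c c'
        (trans (sym (Vec.tabulate∘lookup _)) (trans (Vec.tabulate-cong same) (Vec.tabulate∘lookup _)))

  dim-mono : IsSubspace T → S ⊆ T → HasDim S p → HasDim T q → p ≤ q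
  dim-mono T-sub S⊆T (v , vS , v-ind , _) (w , _ , _ , w-spans) =
    independent≤spanning v w v-ind (λ i → S⊆T _ (vS i)) T-sub w-spans

  dim-unique : IsSubspace S → HasDim S p → HasDim S q → p ≡ q
  dim-unique S-sub S-dim S-dim′ =
    ℕ.≤-antisym (dim-mono S-sub (λ _ Sx → Sx) S-dim S-dim′) (dim-mono S-sub (λ _ Sx → Sx) S-dim′ S-dim)

  ∉-∷-independent : IsSubspace S → {v : Fin p → Vect F m} → (∀ i → S (v i)) → Independent v →
                    ¬ S x → Independent (x ∷ᶠ v)
  ∉-∷-independent {S = S} S-sub {v} vS v-ind x∉S =
    ∷-independent v-ind λ (c , x≡) → x∉S (subst S (sym x≡) (lincomb-∈ S-sub v vS c))

  -- Otherwise adjoining a vector outside the span gives dim S + 1 independent vectors in S.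
  independent⇒spans : IsSubspace S → HasDim S p → (v : Fin p → Vect F m) →
                      Independent v → (∀ i → S (v i)) → Spans S v
  independent⇒spans S-sub (w , _ , _ , w-spans) v v-ind vS x Sx with x ∈Span? v
  ... | yes x∈v = x∈v
  ... | no  x∉v = ⊥-elim (ℕ.1+n≰n
          (independent≤spanning (x ∷ᶠ v) w (∷-independent v-ind x∉v)
             (λ { zero → Sx ; (suc i) → vS i }) S-sub w-spans))

  ∈-decidable : IsSubspace S → HasDim S p → ∀ x → Dec (S x)
  ∈-decidable {S = S} S-sub (b , bS , _ , b-spans) x =
    map′ (λ (c , x≡) → subst S (sym x≡) (lincomb-∈ S-sub b bS c)) (b-spans x) (x ∈Span? b)

  -- Greedy basis construction; the fuel n is enough because independent families have at most m vectors.
  decidable⇒hasDim : ∀ {m} {S : Subset F m} → IsSubspace S → (∀ x → Dec (S x)) → ∃[ p ] HasDim S p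
  decidable⇒hasDim {m} {S} S-sub S? = extend {0} (suc m) (λ ()) (λ ()) (λ _ _ ()) ℕ.≤-refl
    where
      extend : ∀ n (v : Fin p → Vect F m) → (∀ i → S (v i)) → Independent v → m < p ℕ.+ n →
               ∃[ p ] HasDim S p
      extend {p} n v vS v-ind _ with anyᵥ? (λ x → S x × ¬ x ∈Span v) (λ x → S? x ×-dec ¬? (x ∈Span? v))
      ... | no ∄ = p , v , vS , v-ind ,
                   λ x Sx → decidable-stable (x ∈Span? v) (λ x∉v → ∄ (x , Sx , x∉v))
      extend {p} zero v vS v-ind m<p+0 | yes _ =
        ⊥-elim (ℕ.<⇒≱ (subst (m <_) (ℕ.+-identityʳ p) m<p+0) (independent≤ambient v v-ind))
      extend {p} (suc n) v vS v-ind m<p+1+n | yes (x , Sx , x∉v) =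
        extend n (x ∷ᶠ v) (λ { zero → Sx ; (suc i) → vS i }) (∷-independent v-ind x∉v)
          (subst (m <_) (ℕ.+-suc p n) m<p+1+n)

  ⊆⊎∃∉ : IsSubspace U → (∀ x → Dec (U x)) → HasDim W q → W ⊆ U ⊎ ∃[ z ] (W z × ¬ U z)
  ⊆⊎∃∉ {U = U} U-sub U? (b , bW , _ , b-spans) with Fin.any? (λ i → ¬? (U? (b i)))
  ... | yes (i , bᵢ∉U) = inj₂ (b i , bW i , bᵢ∉U)
  ... | no  ∄ = inj₁ λ x Wx →
          let (c , x≡) = b-spans x Wx
              bU = λ i → decidable-stable (U? (b i)) (λ bᵢ∉U → ∄ (i , bᵢ∉U))
          in subst U (sym x≡) (lincomb-∈ U-sub b bU c)

  ∩-isSubspace : IsSubspace S → IsSubspace T → IsSubspace (_∩_ F S T)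
  ∩-isSubspace S-sub T-sub = record
    { zero∈ = zero∈ S-sub , zero∈ T-sub
    ; ⊕∈    = λ x y (Sx , Tx) (Sy , Ty) → ⊕∈ S-sub x y Sx Sy , ⊕∈ T-sub x y Tx Ty
    ; ·∈    = λ c x (Sx , Tx) → ·∈ S-sub c x Sx , ·∈ T-sub c x Tx }

  span-isSubspace : IsSubspace S → IsSubspace T → IsSubspace (span S T)
  span-isSubspace S-sub T-sub = record
    { zero∈ = 0ᵥ , 0ᵥ , zero∈ S-sub , zero∈ T-sub , sym (⊕-identityˡ 0ᵥ)
    ; ⊕∈    = λ { x y (s , t , Ss , Tt , x≡) (s' , t' , Ss' , Tt' , y≡) →
                s ⊕ s' , t ⊕ t' , ⊕∈ S-sub s s' Ss Ss' , ⊕∈ T-sub t t' Tt Tt' ,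
                trans (cong₂ _⊕_ x≡ y≡) (⊕.interchange s t s' t') }
    ; ·∈    = λ { c x (s , t , Ss , Tt , x≡) →
                c · s , c · t , ·∈ S-sub c s Ss , ·∈ T-sub c t Tt ,
                trans (cong (c ·_) x≡) (·-distribˡ c s t) } }

  ⊆-spanˡ : IsSubspace T → S ⊆ span S T
  ⊆-spanˡ T-sub x Sx = x , 0ᵥ , Sx , zero∈ T-sub , sym (⊕-identityʳ x)

  ⊆-spanʳ : IsSubspace S → T ⊆ span S T
  ⊆-spanʳ S-sub x Tx = 0ᵥ , x , zero∈ S-sub , Tx , sym (⊕-identityˡ x)

  span-least : IsSubspace U → S ⊆ U → T ⊆ U → span S T ⊆ U
  span-least {U = U} U-sub S⊆U T⊆U x (s , t , Ss , Tt , x≡) =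
    subst U (sym x≡) (⊕∈ U-sub s t (S⊆U s Ss) (T⊆U t Tt))

  IsSubspace-resp-≐ : S ≐ T → IsSubspace S → IsSubspace T
  IsSubspace-resp-≐ (S⊆T , T⊆S) S-sub = record
    { zero∈ = S⊆T _ (zero∈ S-sub)
    ; ⊕∈    = λ x y Tx Ty → S⊆T _ (⊕∈ S-sub x y (T⊆S x Tx) (T⊆S y Ty))
    ; ·∈    = λ c x Tx → S⊆T _ (·∈ S-sub c x (T⊆S x Tx)) }

  HasDim-resp-≐ : S ≐ T → HasDim S p → HasDim T p
  HasDim-resp-≐ (S⊆T , T⊆S) (b , bS , b-ind , b-spans) =
    b , (λ i → S⊆T _ (bS i)) , b-ind , (λ x Tx → b-spans x (T⊆S x Tx))

  spans-summand : IsSubspace U → IsSubspace W → W z → (b : Fin p → Vect F m) → (∀ i → U (b i)) →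
                  {e : Fin q → Vect F m} → Spans (_∩_ F U W) e →
                  Spans (span U W) (z ∷ᶠ b) → Spans W (z ∷ᶠ e)
  spans-summand {W = W} {z = z} U-sub W-sub Wz b bU e-spans zb-spans x Wx
    with zb-spans x (⊆-spanʳ U-sub x Wx)
  ... | c , x≡ with e-spans (lincomb (c ∘ suc) b) (lincomb-∈ U-sub b bU (c ∘ suc) , y∈W)
    where
      y∈W : W (lincomb (c ∘ suc) b)
      y∈W = ∈-cancelˡ W-sub (·∈ W-sub (c zero) z Wz) (subst W x≡ Wx)
  ... | c' , y≡ = (c zero ∷ᶠ c') , trans x≡ (cong (c zero · z ⊕_) y≡)

  spans-sum : IsSubspace U → {e : Fin p → Vect F m} → (∀ i → U (e i)) →
              {b : Fin q → Vect F m} → Spans U b → Spans W (z ∷ᶠ e) → Spans (span U W) (z ∷ᶠ b)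
  spans-sum {z = z} U-sub {e} eU {b} b-spans ze-spans x (s , t , Us , Wt , x≡s⊕t)
    with b-spans s Us | ze-spans t Wt
  ... | d , s≡ | c , t≡ with b-spans (lincomb (c ∘ suc) e) (lincomb-∈ U-sub e eU (c ∘ suc))
  ... | d' , y≡ = (c zero ∷ᶠ λ i → d i + d' i) , (begin
    x                                                  ≡⟨ x≡s⊕t ⟩
    s ⊕ t                                              ≡⟨ cong₂ _⊕_ s≡ t≡ ⟩
    lincomb d b ⊕ (c zero · z ⊕ lincomb (c ∘ suc) e)   ≡⟨ cong (λ y → lincomb d b ⊕ (c zero · z ⊕ y)) y≡ ⟩
    lincomb d b ⊕ (c zero · z ⊕ lincomb d' b)          ≡⟨ ⊕.x∙yz≈y∙xz _ _ _ ⟩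
    c zero · z ⊕ (lincomb d b ⊕ lincomb d' b)          ≡⟨ cong (c zero · z ⊕_) (sym (lincomb-+ d d' b)) ⟩
    c zero · z ⊕ lincomb (λ i → d i + d' i) b          ∎)

  -- Both directions of Grassmann's formula dim (U + W) + dim (U ∩ W) = dim U + dim W
  -- when U ∩ W has codimension one in U and W; the basis of U + W is a basis of U plus one z ∈ W ∖ U.
  dim-∩ : IsSubspace U → IsSubspace W → HasDim U ℓ → HasDim W ℓ → HasDim (span U W) (suc ℓ) →
          ∃[ k ] ℓ ≡ suc k × HasDim (_∩_ F U W) k
  dim-∩ {U = U} {W = W} U-sub W-sub U-dim@(b , bU , b-ind , _) W-dim UW-dim
    with ⊆⊎∃∉ U-sub (∈-decidable U-sub U-dim) W-dim
  ... | inj₁ W⊆U = ⊥-elim (ℕ.1+n≰n (dim-mono U-sub (span-least U-sub (λ _ Ux → Ux) W⊆U) UW-dim U-dim))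
  ... | inj₂ (z , Wz , z∉U)
    with decidable⇒hasDim (∩-isSubspace U-sub W-sub)
           (λ x → ∈-decidable U-sub U-dim x ×-dec ∈-decidable W-sub W-dim x)
  ... | k , I-dim@(e , eI , e-ind , e-spans) = k , dim-unique W-sub W-dim W-dim′ , I-dim
    where
      UW-sub : IsSubspace (span U W)
      UW-sub = span-isSubspace U-sub W-sub
      zb-spans : Spans (span U W) (z ∷ᶠ b)
      zb-spans = independent⇒spans UW-sub UW-dim (z ∷ᶠ b) (∉-∷-independent U-sub bU b-ind z∉U)
                   λ { zero → ⊆-spanʳ U-sub z Wz ; (suc i) → ⊆-spanˡ W-sub (b i) (bU i) }
      W-dim′ : HasDim W (suc k)
      W-dim′ = z ∷ᶠ e , (λ { zero → Wz ; (suc i) → proj₂ (eI i) }) ,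
               ∉-∷-independent U-sub (proj₁ ∘ eI) e-ind z∉U ,
               spans-summand U-sub W-sub Wz b bU e-spans zb-spans

  dim-span : IsSubspace U → IsSubspace W → HasDim (_∩_ F U W) k → HasDim U (suc k) → HasDim W (suc k) →
             HasDim (span U W) (suc (suc k))
  dim-span {U = U} {W = W} U-sub W-sub I-dim@(e , eI , e-ind , _) U-dim@(b , bU , b-ind , b-spans) W-dim
    with ⊆⊎∃∉ U-sub (∈-decidable U-sub U-dim) W-dim
  ... | inj₁ W⊆U =
    ⊥-elim (ℕ.1+n≰n (dim-mono (∩-isSubspace U-sub W-sub) (λ x Wx → W⊆U x Wx , Wx) W-dim I-dim))
  ... | inj₂ (z , Wz , z∉U) =
    z ∷ᶠ b , (λ { zero → ⊆-spanʳ U-sub z Wz ; (suc i) → ⊆-spanˡ W-sub (b i) (bU i) }) ,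
    ∉-∷-independent U-sub bU b-ind z∉U ,
    spans-sum U-sub (proj₁ ∘ eI) {b} b-spans
      (independent⇒spans W-sub W-dim (z ∷ᶠ e) (∉-∷-independent U-sub (proj₁ ∘ eI) e-ind z∉U)
         λ { zero → Wz ; (suc i) → proj₂ (eI i) })

module PolarSpaceLattice (F : FiniteField) where

  open LinearAlgebra F

  Isotropic-antitone : ∀ {d} (P : PolarSpace F d) {S T : Subset F (dim F P)} →
                       S ⊆ T → Isotropic F P T → Isotropic F P S
  Isotropic-antitone (symplectic _ _)        S⊆T T-iso x y Sx Sy = T-iso x y (S⊆T x Sx) (S⊆T y Sy)
  Isotropic-antitone (parabolic _ _)         S⊆T T-iso x Sx      = T-iso x (S⊆T x Sx)
  Isotropic-antitone (hyperbolic _ _ _)      S⊆T T-iso x Sx      = T-iso x (S⊆T x Sx)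
  Isotropic-antitone (elliptic _ _ _)        S⊆T T-iso x Sx      = T-iso x (S⊆T x Sx)
  Isotropic-antitone (hermitianOdd _ _ _ _)  S⊆T T-iso x y Sx Sy = T-iso x y (S⊆T x Sx) (S⊆T y Sy)
  Isotropic-antitone (hermitianEven _ _ _ _) S⊆T T-iso x y Sx Sy = T-iso x y (S⊆T x Sx) (S⊆T y Sy)

  module _ {d : ℕ} (P : PolarSpace F d) where

    private
      variable
        k ℓ : ℕ
        S T I u w j : Subset F (dim F P)

    InΩ-resp-≐ : S ≐ T → InΩ F P ℓ S → InΩ F P ℓ T
    InΩ-resp-≐ S≐T@(_ , T⊆S) (S-sub , S-iso , S-dim , ℓ≤d) =
      IsSubspace-resp-≐ S≐T S-sub , Isotropic-antitone P T⊆S S-iso , HasDim-resp-≐ S≐T S-dim , ℓ≤d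

    Rank⇒InΩ : Rank F P S ℓ → ℓ ≤ d → InΩ F P ℓ S
    Rank⇒InΩ (inj₁ S∈Ω)         _   = S∈Ω
    Rank⇒InΩ (inj₂ (_ , refl)) ℓ≤d = ⊥-elim (ℕ.1+n≰n ℓ≤d)

    nonmaximal⇒<d : InΩ F P ℓ S → ¬ InX F P S → ℓ < d
    nonmaximal⇒<d {S = S} S∈Ω@(_ , _ , _ , ℓ≤d) S∉X =
      ℕ.≤∧≢⇒< ℓ≤d (λ ℓ≡d → S∉X (subst (λ l → InΩ F P l S) ℓ≡d S∈Ω))

    InΩ⇒Covers : S ⊆ T → InΩ F P ℓ S → InΩ F P (suc ℓ) T → Covers F P T S
    InΩ⇒Covers S⊆T S∈Ω T∈Ω = S⊆T , _ , inj₁ S∈Ω , inj₁ T∈Ω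

    -- If T = V had rank ℓ + 1 = d + 1, then S would be maximal.
    nonmaximal-covered⇒InΩ : ¬ InX F P S → Rank F P S ℓ → Rank F P T (suc ℓ) →
                             InΩ F P ℓ S × InΩ F P (suc ℓ) T
    nonmaximal-covered⇒InΩ _ S-rank (inj₁ T∈Ω@(_ , _ , _ , 1+ℓ≤d)) =
      Rank⇒InΩ S-rank (ℕ.<⇒≤ 1+ℓ≤d) , T∈Ω
    nonmaximal-covered⇒InΩ S∉X S-rank (inj₂ (_ , refl)) = ⊥-elim (S∉X (Rank⇒InΩ S-rank ℕ.≤-refl))

    -- If u = V covered I = u ∩ w, then w = I would be maximal.
    meet-covered⇒InΩ : ¬ InX F P w → (∀ x → u x → w x → I x) → I ⊆ w →
                       Rank F P I k → Rank F P u (suc k) → InΩ F P k I × InΩ F P (suc k) u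
    meet-covered⇒InΩ _ _ _ I-rank (inj₁ u∈Ω@(_ , _ , _ , 1+k≤d)) =
      Rank⇒InΩ I-rank (ℕ.<⇒≤ 1+k≤d) , u∈Ω
    meet-covered⇒InΩ w∉X u∩w⊆I I⊆w I-rank (inj₂ (u-full , refl)) =
      ⊥-elim (w∉X (InΩ-resp-≐ (I⊆w , λ x wx → u∩w⊆I x (u-full x) wx) (Rank⇒InΩ I-rank ℕ.≤-refl)))

    isotropic-join⇒≐span : IsJoin F P u w j → Isotropic F P j → j ≐ span u w
    isotropic-join⇒≐span (inj₁ (_ , j≐)) _ = j≐
    isotropic-join⇒≐span (inj₂ (¬iso , j-full)) j-iso =
      ⊥-elim (¬iso (Isotropic-antitone P (λ x _ → j-full x) j-iso))

    proper-join⇒≐span : IsJoin F P u w j → ¬ Full F j → Isotropic F P (span u w) × j ≐ span u w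
    proper-join⇒≐span (inj₁ join)          _        = join
    proper-join⇒≐span (inj₂ (_ , j-full)) j-proper = ⊥-elim (j-proper j-full)

    join-covers⇒meet-covered : ¬ InX F P u → ¬ InX F P w → IsJoin F P u w j →
                               Covers F P j u → Covers F P j w →
                               Covers F P u (_∩_ F u w) × Covers F P w (_∩_ F u w)
    join-covers⇒meet-covered {u = u} {w = w} u∉X w∉X join (_ , _ , u-rank , j-rank) (_ , _ , w-rank , j-rank′)
      with nonmaximal-covered⇒InΩ u∉X u-rank j-rank | nonmaximal-covered⇒InΩ w∉X w-rank j-rank′
    ... | u∈Ω@(u-sub , u-iso , u-dim , ℓ≤d) , (j-sub , j-iso , j-dim , _)
        | w∈Ω@(w-sub , _ , w-dim , _) , (_ , _ , j-dim′ , _)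
      with dim-unique j-sub j-dim j-dim′
    ... | refl with dim-∩ u-sub w-sub u-dim w-dim (HasDim-resp-≐ (isotropic-join⇒≐span join j-iso) j-dim)
    ... | k , refl , I-dim = InΩ⇒Covers (λ _ → proj₁) I∈Ω u∈Ω , InΩ⇒Covers (λ _ → proj₂) I∈Ω w∈Ω
      where
        I∈Ω : InΩ F P k (_∩_ F u w)
        I∈Ω = ∩-isSubspace u-sub w-sub , Isotropic-antitone P (λ _ → proj₁) u-iso , I-dim , ℕ.<⇒≤ ℓ≤d

    meet-covered⇒join-covers : ¬ InX F P u → ¬ InX F P w → IsJoin F P u w j → ¬ Full F j →
                               Covers F P u (_∩_ F u w) → Covers F P w (_∩_ F u w) →
                               Covers F P j u × Covers F P j w
    meet-covered⇒join-covers {j = j} u∉X w∉X join j-proper (_ , k , I-rank , u-rank) (_ , _ , I-rank′ , w-rank)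
      with meet-covered⇒InΩ w∉X (λ _ ux wx → ux , wx) (λ _ → proj₂) I-rank u-rank
         | meet-covered⇒InΩ u∉X (λ _ wx ux → ux , wx) (λ _ → proj₁) I-rank′ w-rank
    ... | (I-sub , _ , I-dim , _) , u∈Ω@(u-sub , _ , u-dim , _)
        | (_ , _ , I-dim′ , _) , w∈Ω@(w-sub , _ , w-dim , _)
      with dim-unique I-sub I-dim I-dim′ | proper-join⇒≐span join j-proper
    ... | refl | span-iso , j⊆span , span⊆j =
      InΩ⇒Covers (λ x ux → span⊆j x (⊆-spanˡ w-sub x ux)) u∈Ω j∈Ω ,
      InΩ⇒Covers (λ x wx → span⊆j x (⊆-spanʳ u-sub x wx)) w∈Ω j∈Ω
      where
        j∈Ω : InΩ F P (suc (suc k)) j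
        j∈Ω = InΩ-resp-≐ (span⊆j , j⊆span)
                (span-isSubspace u-sub w-sub , span-iso , dim-span u-sub w-sub I-dim u-dim w-dim ,
                 nonmaximal⇒<d u∈Ω u∉X)

mainTheorem18 : (F : FiniteField) (d : ℕ) → 1 < d → (P : PolarSpace F d)
    → (u w : Subset F (dim F P))
    → InL F P u → InL F P w → ¬ InX F P u → ¬ InX F P w
    → (j : Subset F (dim F P)) → IsJoin F P u w j
    → ((Covers F P j u × Covers F P j w)
         → (Covers F P u (_∩_ F u w) × Covers F P w (_∩_ F u w)))
      × ((Covers F P u (_∩_ F u w) × Covers F P w (_∩_ F u w))
         → ¬ Full F j
         → (Covers F P j u × Covers F P j w))
mainTheorem18 F d _ P u w _ _ u∉X w∉X j join =
    (λ (j⋗u , j⋗w) → join-covers⇒meet-covered P u∉X w∉X join j⋗u j⋗w)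
  , (λ (u⋗I , w⋗I) j-proper → meet-covered⇒join-covers P u∉X w∉X join j-proper u⋗I w⋗I)
  where open PolarSpaceLattice F
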